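{- Consider a normalized instance of \textsc{Constrained Layer Tree} with $\ell_i=0$ for all layers $i$. Let $c\in\mathbb N^{\lambda+1}$ be a partial solution with $c_0>1$ leaves. Then there exist partial solutions $a,b\in\mathbb N^{\lambda+1}$ with $a_0<c_0$ and $b_0<c_0$ leaves such that $c$ is the $k$-combination of $a$ and $b$ for some $k$.
   Context: A layer tree with layers $0,\dots,\lambda$ is a rooted tree whose leaves are in layer $0$, with exactly one root in layer $\lambda$, every edge going from a vertex in layer $i-1$ to its parent in layer $i$. The weight $w(v)$ of a vertex is the number of leaves in its subtree. An instance of \textsc{Constrained Layer Tree} is given by nonnegative integers $n_0$ and $(n_i,\ell_i,u_i)_{i\in\{1,\dots,\lambda\}}$; a layer tree is valid if it has at most $n_i$ vertices in layer $i$ for every $i$ and every vertex $v$ in layer $i\ge1$ satisfies $\ell_i\le w(v)\le u_i$. The instance is normalized if $n_i\le n_{i-1}$, $\ell_i\ge\ell_{i-1}$, $u_i\ge u_{i-1}$ for all $i\in\{1,\dots,\lambda\}$ (with $\ell_0=u_0=1$). A vector $a=(a_0,\dots,a_\lambda)\in\mathbb N^{\lambda+1}$ is a partial solution (with $a_0$ leaves) if there is a valid layer tree with exactly $a_i$ vertices in layer $i$ for each $i$. The branching layer of such a vector is the highest $i$ with $a_i>1$ (and $0$ if no such layer exists). For partial solutions $a,b$ with branching layers $k_a,k_b$ and $k\in\{\max\{k_a,k_b\},\dots,\lambda\}$, the $k$-combination of $a$ and $b$ is the vector $(a_0+b_0,\dots,a_k+b_k,1,\dots,1)$. -}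

module Defs where

open import Data.Nat using (ℕ; zero; suc; _+_; _≤_; _<_; _⊔_; _≡ᵇ_; _<ᵇ_; _≤ᵇ_)
open import Data.Fin using (Fin; toℕ; fromℕ; inject₁)
open import Data.Bool using (if_then_else_)
open import Data.Product using (_×_; Σ; ∃)
open import Data.Unit using (⊤)
open import Data.Sum using (_⊎_)
open import Relation.Binary.PropositionalEquality using (_≡_)

-- Layer trees.  'LTree i' is a (sub)tree whose root lies in layer i.
mutual
  data LTree : ℕ → Set where
    leaf : LTree 0
    node : ∀ {i} → Forest i → LTree (suc i)

  data Forest (i : ℕ) : Set where
    [_] : LTree i → Forest i
    _∷_ : LTree i → Forest i → Forest i

mutual
  weight : ∀ {i} → LTree i → ℕ
  weight leaf     = 1
  weight (node f) = weightF f

  weightF : ∀ {i} → Forest i → ℕ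
  weightF [ t ]    = weight t
  weightF (t ∷ f)  = weight t + weightF f

mutual
  count : ∀ {i} → ℕ → LTree i → ℕ
  count j leaf           = if j ≡ᵇ 0 then 1 else 0
  count j (node {i} f)   = (if j ≡ᵇ suc i then 1 else 0) + countF j f

  countF : ∀ {i} → ℕ → Forest i → ℕ
  countF j [ t ]    = count j t
  countF j (t ∷ f)  = count j t + countF j f

-- An instance of Constrained Layer Tree: λ, and n_i, ℓ_i, u_i.
-- n i is used for i ∈ {0..λ}, ℓ i and u i for i ∈ {1..λ}
-- (values outside these ranges are irrelevant).
record Instance : Set where
  field
    λ′ : ℕ
    n  : ℕ → ℕ
    ℓ  : ℕ → ℕ
    u  : ℕ → ℕ
open Instance public

mutual
  WeightsOK : (I : Instance) → ∀ {i} → LTree i → Set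
  WeightsOK I leaf         = ⊤
  WeightsOK I (node {i} f) =
    (ℓ I (suc i) ≤ weightF f) × (weightF f ≤ u I (suc i)) × WeightsOKF I f

  WeightsOKF : (I : Instance) → ∀ {i} → Forest i → Set
  WeightsOKF I [ t ]   = WeightsOK I t
  WeightsOKF I (t ∷ f) = WeightsOK I t × WeightsOKF I f

Valid : (I : Instance) → LTree (λ′ I) → Set
Valid I t = (∀ i → i ≤ λ′ I → count i t ≤ n I i) × WeightsOK I t

-- Normalized: n_i ≤ n_{i-1} and u_i ≥ u_{i-1} for i ∈ {1..λ} with u_0 = 1.
-- (The condition ℓ_i ≥ ℓ_{i-1} is omitted.)
Normalized : Instance → Set
Normalized I =
  (∀ i → suc i ≤ λ′ I → n I (suc i) ≤ n I i) ×
  (λ′ I ≡ 0 ⊎ 1 ≤ u I 1) ×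
  (∀ i → 1 ≤ i → suc i ≤ λ′ I → u I i ≤ u I (suc i))

Vec′ : ℕ → Set
Vec′ m = Fin (suc m) → ℕ

PartialSolution : (I : Instance) → Vec′ (λ′ I) → Set
PartialSolution I a =
  Σ (LTree (λ′ I)) λ t → Valid I t × (∀ (i : Fin (suc (λ′ I))) → count (toℕ i) t ≡ a i)

branching : ∀ {m} → (Fin (suc m) → ℕ) → ℕ
branching {zero}  a = 0
branching {suc m} a =
  if 1 <ᵇ a (fromℕ (suc m)) then suc m else branching {m} (λ i → a (inject₁ i))

combination : ∀ {m} → ℕ → (Fin (suc m) → ℕ) → (Fin (suc m) → ℕ) → Fin (suc m) → ℕ
combination k a b i = if toℕ i ≤ᵇ k then a i + b i else 1

{-# OPTIONS --safe #-}
module Submission where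

-- Follow the unary chain below the root down to the first vertex v with at
-- least two children; its children lie in layer k.  Keeping the chain above v
-- and, at v, either only the first child or only the remaining children gives
-- two trees a, b.  In layers ≤ k their vertex counts add up to those of c, in
-- layers > k all three trees have exactly one vertex, and both parts are
-- pieces of the original tree, so they have no more vertices per layer and no
-- heavier vertices.  Since every ℓᵢ is 0, no lower bound can be violated.

open import Defs
open import Data.Nat using (ℕ; zero; suc; _+_; _≤_; _<_; _⊔_; _≡ᵇ_; _<ᵇ_; _≤ᵇ_; z≤n; s≤s)
open import Data.Nat.Properties
open import Data.Fin using (Fin; zero; toℕ; fromℕ; inject₁)
open import Data.Fin.Properties using (toℕ≤pred[n]; toℕ-inject₁; toℕ-fromℕ)
open import Data.Bool using (true; false)
open import Data.Product using (Σ; _×_; _,_; proj₂)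
open import Data.Sum using (inj₁; inj₂)
open import Data.Empty using (⊥-elim)
open import Relation.Nullary.Reflects using (ofʸ; ofⁿ)
open import Relation.Binary.PropositionalEquality
  using (_≡_; _≢_; refl; sym; trans; cong; subst)

≡ᵇ-refl : ∀ n → (n ≡ᵇ n) ≡ true
≡ᵇ-refl zero    = refl
≡ᵇ-refl (suc n) = ≡ᵇ-refl n

≢⇒≡ᵇ≡false : ∀ {m n} → m ≢ n → (m ≡ᵇ n) ≡ false
≢⇒≡ᵇ≡false {zero}  {zero}  m≢n = ⊥-elim (m≢n refl)
≢⇒≡ᵇ≡false {zero}  {suc n} _   = refl
≢⇒≡ᵇ≡false {suc m} {zero}  _   = refl
≢⇒≡ᵇ≡false {suc m} {suc n} m≢n = ≢⇒≡ᵇ≡false (λ m≡n → m≢n (cong suc m≡n))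

count-above  : ∀ {i j} (t : LTree i) → i < j → count j t ≡ 0
countF-above : ∀ {i j} (f : Forest i) → i < j → countF j f ≡ 0

count-above {j = suc j} leaf _ = refl
count-above {suc i} (node f) i<j
  rewrite ≢⇒≡ᵇ≡false (>⇒≢ i<j) = countF-above f (<-trans (n<1+n i) i<j)

countF-above [ t ]   i<j = count-above t i<j
countF-above (t ∷ f) i<j rewrite count-above t i<j = countF-above f i<j

count-leaves-positive  : ∀ {i} (t : LTree i) → 0 < count 0 t
countF-leaves-positive : ∀ {i} (f : Forest i) → 0 < countF 0 f

count-leaves-positive leaf     = s≤s z≤n
count-leaves-positive (node f) = countF-leaves-positive f

countF-leaves-positive [ t ]   = count-leaves-positive t
countF-leaves-positive (t ∷ f) = <-≤-trans (count-leaves-positive t) (m≤m+n _ _)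

count-root : ∀ {i} (f : Forest i) → count (suc i) (node f) ≡ 1
count-root {i} f rewrite ≡ᵇ-refl i | countF-above f (n<1+n i) = refl

ChainAbove : ℕ → ∀ {i} → LTree i → Set
ChainAbove k {i} t = ∀ j → k < j → j ≤ i → count j t ≡ 1

chainAbove-node : ∀ {i} (f : Forest i) → ChainAbove i (node f)
chainAbove-node f j i<j j≤1+i rewrite ≤-antisym j≤1+i i<j = count-root f

chainAbove-unary : ∀ {k i} (s : LTree i) → ChainAbove k s → ChainAbove k (node [ s ])
chainAbove-unary s chain j k<j j≤1+i with m≤n⇒m<n∨m≡n j≤1+i
... | inj₁ j<1+i rewrite ≢⇒≡ᵇ≡false (<⇒≢ j<1+i) = chain j k<j (≤-pred j<1+i)
... | inj₂ refl = count-root [ s ]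

data Side : Set where
  left right : Side

branch : Side → ∀ {i} → LTree i → Forest i → Forest i
branch left  s g = [ s ]
branch right s g = g

part : Side → ∀ {i} → LTree i → LTree i
part σ leaf           = leaf
part σ (node [ s ])   = node [ part σ s ]
part σ (node (s ∷ g)) = node (branch σ s g)

-- The first vertex with two children lies in layer splitLayer t + 1;
-- on a tree with a single leaf the value 0 is junk.
splitLayer : ∀ {i} → LTree i → ℕ
splitLayer leaf               = 0
splitLayer (node [ s ])       = splitLayer s
splitLayer (node {i} (s ∷ g)) = i

countF-branch-≤ : ∀ σ {i} j (s : LTree i) g → countF j (branch σ s g) ≤ countF j (s ∷ g)
countF-branch-≤ left  j s g = m≤m+n _ _
countF-branch-≤ right j s g = m≤n+m _ _

weightF-branch-≤ : ∀ σ {i} (s : LTree i) g → weightF (branch σ s g) ≤ weightF (s ∷ g)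
weightF-branch-≤ left  s g = m≤m+n _ _
weightF-branch-≤ right s g = m≤n+m _ _

weightsOKF-branch : ∀ {I} σ {i} (s : LTree i) g →
  WeightsOKF I (s ∷ g) → WeightsOKF I (branch σ s g)
weightsOKF-branch left  s g (ok , _) = ok
weightsOKF-branch right s g (_ , ok) = ok

count-part-≤ : ∀ σ {i} j (t : LTree i) → count j (part σ t) ≤ count j t
count-part-≤ σ j leaf           = ≤-refl
count-part-≤ σ j (node [ s ])   = +-monoʳ-≤ _ (count-part-≤ σ j s)
count-part-≤ σ j (node (s ∷ g)) = +-monoʳ-≤ _ (countF-branch-≤ σ j s g)

weight-part-≤ : ∀ σ {i} (t : LTree i) → weight (part σ t) ≤ weight t
weight-part-≤ σ leaf           = ≤-refl
weight-part-≤ σ (node [ s ])   = weight-part-≤ σ s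
weight-part-≤ σ (node (s ∷ g)) = weightF-branch-≤ σ s g

chainAbove-splitLayer : ∀ {i} (t : LTree i) → ChainAbove (splitLayer t) t
chainAbove-splitLayer leaf (suc j) _ ()
chainAbove-splitLayer (node [ s ])   = chainAbove-unary s (chainAbove-splitLayer s)
chainAbove-splitLayer (node (s ∷ g)) = chainAbove-node (s ∷ g)

chainAbove-part : ∀ σ {i} (t : LTree i) → ChainAbove (splitLayer t) (part σ t)
chainAbove-part σ leaf (suc j) _ ()
chainAbove-part σ (node [ s ])   = chainAbove-unary (part σ s) (chainAbove-part σ s)
chainAbove-part σ (node (s ∷ g)) = chainAbove-node (branch σ s g)

splitLayer<layer : ∀ {i} (t : LTree i) → 1 < count 0 t → splitLayer t < i
splitLayer<layer leaf           (s≤s ())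
splitLayer<layer (node [ s ])   2≤leaves = m<n⇒m<1+n (splitLayer<layer s 2≤leaves)
splitLayer<layer (node (s ∷ g)) _        = n<1+n _

count-split : ∀ {i j} (t : LTree i) → 1 < count 0 t → j ≤ splitLayer t →
  count j t ≡ count j (part left t) + count j (part right t)
count-split leaf (s≤s ())
count-split (node [ s ]) 2≤leaves j≤k
  rewrite ≢⇒≡ᵇ≡false (<⇒≢ (s≤s (<⇒≤ (≤-<-trans j≤k (splitLayer<layer s 2≤leaves)))))
  = count-split s 2≤leaves j≤k
count-split (node (s ∷ g)) _ j≤i rewrite ≢⇒≡ᵇ≡false (<⇒≢ (s≤s j≤i)) = refl

count-part< : ∀ σ {i} (t : LTree i) → 1 < count 0 t → count 0 (part σ t) < count 0 t
count-part< left t 2≤leaves rewrite count-split t 2≤leaves z≤n =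
  m<m+n _ (count-leaves-positive (part right t))
count-part< right t 2≤leaves rewrite count-split t 2≤leaves z≤n =
  m<n+m _ (count-leaves-positive (part left t))

ZeroLowerBounds : Instance → ℕ → Set
ZeroLowerBounds I i = ∀ j → 1 ≤ j → j ≤ i → ℓ I j ≡ 0

zeroLowerBounds-pred : ∀ {I i} → ZeroLowerBounds I (suc i) → ZeroLowerBounds I i
zeroLowerBounds-pred noLower j 1≤j j≤i = noLower j 1≤j (m≤n⇒m≤1+n j≤i)

weightsOK-node : ∀ {I i} (f : Forest i) → ZeroLowerBounds I (suc i) →
  weightF f ≤ u I (suc i) → WeightsOKF I f → WeightsOK I (node f)
weightsOK-node {i = i} f noLower w≤u ok =
  subst (_≤ _) (sym (noLower (suc i) (s≤s z≤n) ≤-refl)) z≤n , w≤u , ok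

weightsOK-part : ∀ {I} σ {i} → ZeroLowerBounds I i →
  (t : LTree i) → WeightsOK I t → WeightsOK I (part σ t)
weightsOK-part σ _ leaf ok = ok
weightsOK-part {I} σ noLower (node [ s ]) (_ , w≤u , ok) =
  weightsOK-node {I} [ part σ s ] noLower (≤-trans (weight-part-≤ σ s) w≤u)
    (weightsOK-part {I} σ (zeroLowerBounds-pred {I} noLower) s ok)
weightsOK-part {I} σ noLower (node (s ∷ g)) (_ , w≤u , ok) =
  weightsOK-node {I} (branch σ s g) noLower (≤-trans (weightF-branch-≤ σ s g) w≤u)
    (weightsOKF-branch σ s g ok)

countVector : ∀ {m} → LTree m → Vec′ m
countVector t i = count (toℕ i) t

partialSolution-countVector : ∀ {I} {t : LTree (λ′ I)} (x : LTree (λ′ I)) → Valid I t → WeightsOK I x →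
  (∀ j → count j x ≤ count j t) → PartialSolution I (countVector x)
partialSolution-countVector x (fits , _) ok x≤t =
  x , ((λ j j≤λ → ≤-trans (x≤t j) (fits j j≤λ)) , ok) , λ _ → refl

branching-≤ : ∀ {m} (a : Fin (suc m) → ℕ) k → (∀ i → k < toℕ i → a i ≤ 1) → branching a ≤ k
branching-≤ {zero}  a k _ = z≤n
branching-≤ {suc m} a k small
  with 1 <ᵇ a (fromℕ (suc m)) | <ᵇ-reflects-< 1 (a (fromℕ (suc m)))
... | true  | ofʸ 1<top = ≮⇒≥ λ k<top →
  <⇒≱ 1<top (small (fromℕ (suc m)) (subst (k <_) (sym (toℕ-fromℕ (suc m))) k<top))
... | false | ofⁿ _ = branching-≤ (λ i → a (inject₁ i)) k
  λ i k<i → small (inject₁ i) (subst (k <_) (sym (toℕ-inject₁ i)) k<i)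

branching-countVector-≤ : ∀ {k m} (x : LTree m) → ChainAbove k x → branching (countVector x) ≤ k
branching-countVector-≤ x chain =
  branching-≤ _ _ λ i k<i → ≤-reflexive (chain (toℕ i) k<i (toℕ≤pred[n] i))

≗-combination : ∀ {m} k (a b c : Fin (suc m) → ℕ) →
  (∀ i → toℕ i ≤ k → c i ≡ a i + b i) → (∀ i → k < toℕ i → c i ≡ 1) →
  ∀ i → c i ≡ combination k a b i
≗-combination k a b c low high i with toℕ i ≤ᵇ k | ≤ᵇ-reflects-≤ (toℕ i) k
... | true  | ofʸ i≤k = low i i≤k
... | false | ofⁿ i≰k = high i (≰⇒> i≰k)

lemma3p3 : (I : Instance) → Normalized I →
    (∀ i → 1 ≤ i → i ≤ λ′ I → ℓ I i ≡ 0) →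
    (c : Vec′ (λ′ I)) → PartialSolution I c → 1 < c zero →
    Σ (Vec′ (λ′ I)) λ a → Σ (Vec′ (λ′ I)) λ b → Σ ℕ λ k →
      PartialSolution I a × PartialSolution I b ×
      a zero < c zero × b zero < c zero ×
      (branching a ⊔ branching b) ≤ k × k ≤ λ′ I ×
      (∀ (i : Fin _) → c i ≡ combination k a b i)
lemma3p3 I _ noLower c (t , valid , t≗c) 1<c₀ =
  countVector (part left t) , countVector (part right t) , splitLayer t ,
  partial left , partial right , fewerLeaves left , fewerLeaves right ,
  ⊔-lub (branching-countVector-≤ (part left t) (chainAbove-part left t))
        (branching-countVector-≤ (part right t) (chainAbove-part right t)) ,
  <⇒≤ (splitLayer<layer t 2≤leaves) ,
  ≗-combination _ (countVector (part left t)) (countVector (part right t)) c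
    (λ i i≤k → trans (sym (t≗c i)) (count-split t 2≤leaves i≤k))
    (λ i k<i → trans (sym (t≗c i)) (chainAbove-splitLayer t (toℕ i) k<i (toℕ≤pred[n] i)))
  where
    2≤leaves : 1 < count 0 t
    2≤leaves = subst (1 <_) (sym (t≗c zero)) 1<c₀

    partial : ∀ σ → PartialSolution I (countVector (part σ t))
    partial σ = partialSolution-countVector (part σ t) valid
      (weightsOK-part σ noLower t (proj₂ valid)) (λ j → count-part-≤ σ j t)

    fewerLeaves : ∀ σ → count 0 (part σ t) < c zero
    fewerLeaves σ = subst (_ <_) (t≗c zero) (count-part< σ t 2≤leaves)
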